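{- Let $t\ge3$ and $\lambda\ge0$, let $G$ be a graph and $X\subseteq V(G)$ with $\mathsf{bed}^+_t(G-X)\le\lambda$, let $R=V(G)\setminus X$, and let $N$ be a set of non-$K_t$-vertices of $G[R]$. For any $X'\subseteq X$, $N'\subseteq N$, $R'\subseteq R$ such that $R'\cap N'=\emptyset$ and $X'\cup N'$ contains no $t$-clique, we have $\mathsf{conf}^t_{X'\cup N'}(R')=0$ if and only if $\mathsf{conf}^t_{X'}(R'\cup N')=0$.
   Context: A $t$-clique is a set of $t$ pairwise adjacent vertices; $\mathrm{opt}(G)$ is the minimum size of a set intersecting all $t$-cliques of $G$; $N$ is a set of non-$K_t$-vertices of $G[R]$ if no $t$-clique of $G[R]$ meets $N$. For $\mathcal F$ a set of subsets $Z$ with $1\le|Z|\le t-1$ inducing cliques, $\mathrm{opt}(G,\mathcal F)$ is the minimum size of a set intersecting all $t$-cliques of $G$ and all $Z\in\mathcal F$. For disjoint $A,B\subseteq V(G)$, $\mathsf{pr}^t_A(B)=\{K\cap B: K$ a $t$-clique of $G[A\cup B]$ with $K\cap A\ne\emptyset\ne K\cap B\}$. For disjoint $S_1,S_2$ with $S_1$ containing no $t$-clique, $\mathsf{conf}^t_{S_1}(S_2)=\mathrm{opt}(G[S_2],\mathsf{pr}^t_{S_1}(S_2))-\mathrm{opt}(G[S_2])$. For a connected graph, a root is a nonempty $T$ with $G[T]$ connected and $K_t$-free such that each component $C$ of $G-T$ has $|N(C)\cap T|=1$; $\mathsf{bed}^+_t(G)$ is $0$ if $V(G)=\emptyset$,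 $\mathsf{bed}^+_t(G-v)$ if $v$ lies in no $t$-clique, the maximum over components if $G$ is disconnected, and otherwise $1+\min_T\mathsf{bed}^+_t(G-T)$ over roots $T$. -}

module Defs where

open import Data.Nat using (ℕ; zero; suc; _≤_; _∸_)
open import Data.Fin using (Fin)
open import Data.Fin.Subset using (Subset; _∈_; _∉_; _⊆_; _∩_; _∪_; _─_; _-_; ∁; ∣_∣; Nonempty; Empty)
open import Data.Product using (Σ; ∃; _×_; _,_)
open import Relation.Binary.PropositionalEquality using (_≡_; _≢_)
open import Relation.Nullary using (¬_)

record Graph (n : ℕ) : Set₁ where
  field
    E     : Fin n → Fin n → Set
    sym   : ∀ {u v} → E u v → E v u
    irrfl : ∀ {u} → ¬ E u u
open Graph public

module _ {n : ℕ} (G : Graph n) where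

  IsClique : ℕ → Subset n → Set
  IsClique t K = (∣ K ∣ ≡ t) × (∀ u v → u ∈ K → v ∈ K → u ≢ v → E G u v)

  CliqueIn : ℕ → Subset n → Subset n → Set
  CliqueIn t S K = (K ⊆ S) × IsClique t K

  KtFree : ℕ → Subset n → Set
  KtFree t S = ∀ K → ¬ CliqueIn t S K

  NonKtVertex : ℕ → Subset n → Fin n → Set
  NonKtVertex t S v = (v ∈ S) × (∀ K → CliqueIn t S K → v ∉ K)

  NonKtSet : ℕ → Subset n → Subset n → Set
  NonKtSet t R N = (N ⊆ R) × (∀ K → CliqueIn t R K → Empty (N ∩ K))

  Family : Set₁
  Family = Subset n → Set

  emptyFamily : Family
  emptyFamily _ = Data.Empty.⊥
    where import Data.Empty

  Hits : ℕ → Subset n → Family → Subset n → Set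
  Hits t S F H = (H ⊆ S)
               × (∀ K → CliqueIn t S K → Nonempty (H ∩ K))
               × (∀ Z → F Z → Nonempty (H ∩ Z))

  OptIs : ℕ → Subset n → Family → ℕ → Set
  OptIs t S F k = (Σ (Subset n) λ H → Hits t S F H × ∣ H ∣ ≡ k)
                × (∀ H → Hits t S F H → k ≤ ∣ H ∣)

  pr : ℕ → Subset n → Subset n → Family
  pr t A B Z = Σ (Subset n) λ K → CliqueIn t (A ∪ B) K
             × Nonempty (K ∩ A) × Nonempty (K ∩ B) × Z ≡ K ∩ B

  ConfIs : ℕ → Subset n → Subset n → ℕ → Set
  ConfIs t S1 S2 c = Σ ℕ λ a → Σ ℕ λ b →
    OptIs t S2 (pr t S1 S2) a × OptIs t S2 emptyFamily b × c ≡ a ∸ b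

  data Reach (S : Subset n) : Fin n → Fin n → Set where
    here : ∀ {u} → Reach S u u
    step : ∀ {u v w} → E G u v → v ∈ S → Reach S v w → Reach S u w

  Connected : Subset n → Set
  Connected S = ∀ u v → u ∈ S → v ∈ S → Reach S u v

  Component : Subset n → Subset n → Set
  Component S C = (C ⊆ S) × Nonempty C × Connected C
                × (∀ u v → u ∈ C → v ∈ S → v ∉ C → ¬ E G u v)

  AdjTo : Subset n → Fin n → Set
  AdjTo C x = ∃ λ u → u ∈ C × E G u x

  OneNbrIn : Subset n → Subset n → Set
  OneNbrIn T C = ∃ λ x → x ∈ T × AdjTo C x × (∀ y → y ∈ T → AdjTo C y → y ≡ x)

  Root : ℕ → Subset n → Subset n → Set
  Root t S T = Nonempty T × (T ⊆ S) × Connected T × KtFree t T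
             × (∀ C → Component (S ─ T) C → OneNbrIn T C)

  AllInCliques : ℕ → Subset n → Set
  AllInCliques t S = ∀ v → v ∈ S → ∃ λ K → CliqueIn t S K × v ∈ K

  -- BedLe t S k  means  bed⁺_t(G[S]) ≤ k, following the recursive
  -- definition case by case (empty / non-K_t vertex / disconnected / roots).
  data BedLe (t : ℕ) : Subset n → ℕ → Set where
    bed-empty : ∀ {S k} → Empty S → BedLe t S k
    bed-vertex : ∀ {S k} v → NonKtVertex t S v → BedLe t (S - v) k → BedLe t S k
    bed-comp : ∀ {S k} → AllInCliques t S → ¬ Connected S →
               (∀ C → Component S C → BedLe t C k) → BedLe t S k
    bed-root : ∀ {S k} → Nonempty S → AllInCliques t S → Connected S →
               (T : Subset n) → Root t S T → BedLe t (S ─ T) k → BedLe t S (suc k)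

{-# OPTIONS --safe #-}
-- Since N' consists of non-K_t-vertices of G[R], the graphs G[R'] and G[R' ∪ N'] have the same
-- t-cliques, so a transversal of either traces to a transversal of G[R'] and the two optima agree;
-- in particular a minimum transversal of G[R' ∪ N'] lies inside R'. Conflict 0 says that some
-- minimum transversal also meets every projected clique, and for a transversal inside R' the two
-- families of projections are interchangeable: a t-clique meeting X' and R' ∪ N' meets R' because
-- X' ∪ N' is K_t-free, and a t-clique meeting X' ∪ N' and R' meets X' because a t-clique of G[R]
-- avoids N'.
module Submission where

open import Defs
open import Data.Nat using (ℕ; _≤_)
open import Data.Nat.Properties using (≤-trans; <⇒≱; m∸n≡0⇒m≤n; n∸n≡0)
open import Data.Fin.Subset using (Subset; _⊆_; _⊂_; _∩_; _∪_; ∁; ∣_∣; Nonempty; Empty)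
open import Data.Fin.Subset.Properties
open import Data.Product using (∃; _×_; _,_; proj₁; proj₂; map₂)
open import Data.Sum using (inj₁; inj₂; [_,_]′)
open import Data.Empty using (⊥-elim)
open import Function using (_∘_)
open import Function.Bundles using (_⇔_; mk⇔; Equivalence)
open import Relation.Nullary using (yes; no; contradiction)
open import Relation.Binary.PropositionalEquality using (_≡_; refl; trans; cong; subst) renaming (sym to ≡-sym)

open Equivalence using (to; from)

private
  variable
    n : ℕ
    p q r : Subset n

∩-monoʳ-⊆ : q ⊆ r → p ∩ q ⊆ p ∩ r
∩-monoʳ-⊆ {q = q} {p = p} q⊆r x∈p∩q with x∈p∩q⁻ p q x∈p∩q
... | x∈p , x∈q = x∈p∩q⁺ (x∈p , q⊆r x∈q)

∩-monoˡ-⊆ : p ⊆ q → p ∩ r ⊆ q ∩ r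
∩-monoˡ-⊆ {p = p} {r = r} p⊆q x∈p∩r with x∈p∩q⁻ p r x∈p∩r
... | x∈p , x∈r = x∈p∩q⁺ (p⊆q x∈p , x∈r)

∪-lub : p ⊆ r → q ⊆ r → p ∪ q ⊆ r
∪-lub {p = p} {q = q} p⊆r q⊆r = [ p⊆r , q⊆r ]′ ∘ x∈p∪q⁻ p q

p⊆q∪r∧p∩q≡∅⇒p⊆r : p ⊆ q ∪ r → Empty (p ∩ q) → p ⊆ r
p⊆q∪r∧p∩q≡∅⇒p⊆r {q = q} {r = r} p⊆q∪r p∩q≡∅ {x} x∈p with x∈p∪q⁻ q r (p⊆q∪r x∈p)
... | inj₁ x∈q = contradiction (x , x∈p∩q⁺ (x∈p , x∈q)) p∩q≡∅
... | inj₂ x∈r = x∈r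

p⊆q∪r∧p∩r≡∅⇒p⊆q : p ⊆ q ∪ r → Empty (p ∩ r) → p ⊆ q
p⊆q∪r∧p∩r≡∅⇒p⊆q {q = q} {r = r} p⊆q∪r = p⊆q∪r∧p∩q≡∅⇒p⊆r (⊆-trans p⊆q∪r (⊆-reflexive (∪-comm q r)))

p∩[q∪r]≢∅∧p∩q≡∅⇒p∩r≢∅ : Nonempty (p ∩ (q ∪ r)) → Empty (p ∩ q) → Nonempty (p ∩ r)
p∩[q∪r]≢∅∧p∩q≡∅⇒p∩r≢∅ {p = p} {q = q} {r = r} (x , x∈p∩[q∪r]) p∩q≡∅
  with x∈p∩q⁻ p (q ∪ r) x∈p∩[q∪r]
... | x∈p , x∈q∪r with x∈p∪q⁻ q r x∈q∪r
...   | inj₁ x∈q = contradiction (x , x∈p∩q⁺ (x∈p , x∈q)) p∩q≡∅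
...   | inj₂ x∈r = x , x∈p∩q⁺ (x∈p , x∈r)

∣p∣≤∣p∩q∣⇒p⊆q : ∣ p ∣ ≤ ∣ p ∩ q ∣ → p ⊆ q
∣p∣≤∣p∩q∣⇒p⊆q {p = p} {q} ∣p∣≤∣p∩q∣ {x} x∈p with x ∈? q
... | yes x∈q = x∈q
... | no x∉q = contradiction ∣p∣≤∣p∩q∣ (<⇒≱ (p⊂q⇒∣p∣<∣q∣ p∩q⊂p))
  where
  p∩q⊂p : p ∩ q ⊂ p
  p∩q⊂p = p∩q⊆p p q , x , x∈p , x∉q ∘ proj₂ ∘ x∈p∩q⁻ p q

module _ (G : Graph n) (t : ℕ) where

  MeetsAll : Family G → Subset n → Set
  MeetsAll F H = ∀ Z → F Z → Nonempty (H ∩ Z)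

  OptAtLeast : Subset n → ℕ → Set
  OptAtLeast S k = ∀ H → Hits G t S (emptyFamily G) H → k ≤ ∣ H ∣

  hits-forget : ∀ {S F H} → Hits G t S F H → Hits G t S (emptyFamily G) H
  hits-forget (H⊆S , meetsCliques , _) = H⊆S , meetsCliques , λ _ ()

  MinimumTransversalMeetsPr : Subset n → Subset n → Set
  MinimumTransversalMeetsPr S₁ S₂ = ∃ λ H → Hits G t S₂ (pr G t S₁ S₂) H × OptAtLeast S₂ ∣ H ∣

  -- Since ∸ truncates, conf = 0 only yields opt(G[S₂], pr) ≤ opt(G[S₂]); that suffices because
  -- the reverse inequality always holds.
  conf≡0⇔ : ∀ {S₁ S₂} → ConfIs G t S₁ S₂ 0 ⇔ MinimumTransversalMeetsPr S₁ S₂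
  conf≡0⇔ {S₁} {S₂} = mk⇔ minimal⇒ ⇒minimal
    where
    minimal⇒ : ConfIs G t S₁ S₂ 0 → MinimumTransversalMeetsPr S₁ S₂
    minimal⇒ (_ , _ , ((H , hits , refl) , _) , (_ , optAtLeast) , a∸b≡0) =
      H , hits , λ H′ hits′ → ≤-trans (m∸n≡0⇒m≤n (≡-sym a∸b≡0)) (optAtLeast H′ hits′)
    ⇒minimal : MinimumTransversalMeetsPr S₁ S₂ → ConfIs G t S₁ S₂ 0
    ⇒minimal (H , hits , optAtLeast) =
      ∣ H ∣ , ∣ H ∣
      , ((H , hits , refl) , λ H′ hits′ → optAtLeast H′ (hits-forget hits′))
      , ((H , hits-forget hits , refl) , optAtLeast)
      , ≡-sym (n∸n≡0 ∣ H ∣)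

  cliqueIn-mono : ∀ {S S′ K} → S ⊆ S′ → CliqueIn G t S K → CliqueIn G t S′ K
  cliqueIn-mono S⊆S′ (K⊆S , clique) = ⊆-trans K⊆S S⊆S′ , clique

  hits-restrict : ∀ {S S′ F H} → S ⊆ S′ → Hits G t S′ F H → Hits G t S (emptyFamily G) (H ∩ S)
  hits-restrict {S} {H = H} S⊆S′ (_ , meetsCliques , _) = p∩q⊆q H S , meetsCliques′ , λ _ ()
    where
    meetsCliques′ : ∀ K → CliqueIn G t S K → Nonempty ((H ∩ S) ∩ K)
    meetsCliques′ K c@(K⊆S , _) with meetsCliques K (cliqueIn-mono S⊆S′ c)
    ... | x , x∈H∩K with x∈p∩q⁻ H K x∈H∩K
    ...   | x∈H , x∈K = x , x∈p∩q⁺ (x∈p∩q⁺ (x∈H , K⊆S x∈K) , x∈K)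

  module _ {S S′ : Subset n} (S⊆S′ : S ⊆ S′) (cliques⊆S : ∀ K → CliqueIn G t S′ K → K ⊆ S) where

    hits-extend : ∀ {F H} → Hits G t S F H → Hits G t S′ F H
    hits-extend (H⊆S , meetsCliques , meetsF) =
      ⊆-trans H⊆S S⊆S′ , (λ K c → meetsCliques K (cliques⊆S K c , proj₂ c)) , meetsF

    optAtLeast⇔ : ∀ {k} → OptAtLeast S k ⇔ OptAtLeast S′ k
    optAtLeast⇔ = mk⇔
      (λ optAtLeast H hits → ≤-trans (optAtLeast (H ∩ S) (hits-restrict S⊆S′ hits)) (∣p∩q∣≤∣p∣ H S))
      (λ optAtLeast H hits → optAtLeast H (hits-extend hits))

  nonKtSet-anti : ∀ {W N N′} → N′ ⊆ N → NonKtSet G t W N → NonKtSet G t W N′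
  nonKtSet-anti N′⊆N (N⊆W , avoid) = ⊆-trans N′⊆N N⊆W , λ K c → avoid K c ∘ map₂ (∩-monoˡ-⊆ N′⊆N)

  cliques-avoid-nonKt : ∀ {W B S} → NonKtSet G t W B → S ⊆ W →
                        ∀ K → CliqueIn G t (S ∪ B) K → K ⊆ S
  cliques-avoid-nonKt {B = B} (B⊆W , avoid) S⊆W K (K⊆S∪B , clique) =
    p⊆q∪r∧p∩r≡∅⇒p⊆q K⊆S∪B
      (avoid K (⊆-trans K⊆S∪B (∪-lub S⊆W B⊆W) , clique) ∘ subst Nonempty (∩-comm K B))

  module _ {A B R : Subset n} where

    private
      ∪-reassoc : (A ∪ B) ∪ R ≡ A ∪ (R ∪ B)
      ∪-reassoc = trans (∪-assoc A B R) (cong (A ∪_) (∪-comm B R))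

    meetsAll-pr-shiftʳ : ∀ {H} → KtFree G t (A ∪ B) →
                         MeetsAll (pr G t (A ∪ B) R) H → MeetsAll (pr G t A (R ∪ B)) H
    meetsAll-pr-shiftʳ free meets Z (K , (K⊆A∪[R∪B] , clique) , K∩A≢∅ , _ , refl)
      with nonempty? (K ∩ R)
    ... | yes K∩R≢∅ = map₂ (∩-monoʳ-⊆ (∩-monoʳ-⊆ (p⊆p∪q B))) (meets (K ∩ R) K∩R∈pr)
      where
      K∩R∈pr : pr G t (A ∪ B) R (K ∩ R)
      K∩R∈pr = K , (⊆-trans K⊆A∪[R∪B] (⊆-reflexive (≡-sym ∪-reassoc)) , clique)
             , map₂ (∩-monoʳ-⊆ (p⊆p∪q B)) K∩A≢∅ , K∩R≢∅ , refl
    ... | no K∩R≡∅ = ⊥-elim (free K (K⊆A∪B , clique))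
      where
      K⊆A∪B : K ⊆ A ∪ B
      K⊆A∪B = p⊆q∪r∧p∩r≡∅⇒p⊆q (⊆-trans K⊆A∪[R∪B] (⊆-reflexive (≡-sym ∪-reassoc))) K∩R≡∅

    meetsAll-pr-shiftˡ : ∀ {W H} → NonKtSet G t W B → R ⊆ W → H ⊆ R →
                         MeetsAll (pr G t A (R ∪ B)) H → MeetsAll (pr G t (A ∪ B) R) H
    meetsAll-pr-shiftˡ {H = H} (B⊆W , avoid) R⊆W H⊆R meets Z
                       (K , (K⊆[A∪B]∪R , clique) , K∩[A∪B]≢∅ , K∩R≢∅ , refl)
      with nonempty? (K ∩ A)
    ... | yes K∩A≢∅ = map₂ narrow (meets (K ∩ (R ∪ B)) K∩[R∪B]∈pr)
      where
      K∩[R∪B]∈pr : pr G t A (R ∪ B) (K ∩ (R ∪ B))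
      K∩[R∪B]∈pr = K , (⊆-trans K⊆[A∪B]∪R (⊆-reflexive ∪-reassoc) , clique)
                 , K∩A≢∅ , map₂ (∩-monoʳ-⊆ (p⊆p∪q B)) K∩R≢∅ , refl
      narrow : H ∩ (K ∩ (R ∪ B)) ⊆ H ∩ (K ∩ R)
      narrow x∈H∩K∩[R∪B] with x∈p∩q⁻ H _ x∈H∩K∩[R∪B]
      ... | x∈H , x∈K∩[R∪B] = x∈p∩q⁺ (x∈H , x∈p∩q⁺ (proj₁ (x∈p∩q⁻ K _ x∈K∩[R∪B]) , H⊆R x∈H))
    ... | no K∩A≡∅ = ⊥-elim (avoid K (⊆-trans K⊆R∪B (∪-lub R⊆W B⊆W) , clique) B∩K≢∅)
      where
      K⊆R∪B : K ⊆ R ∪ B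
      K⊆R∪B = p⊆q∪r∧p∩q≡∅⇒p⊆r (⊆-trans K⊆[A∪B]∪R (⊆-reflexive ∪-reassoc)) K∩A≡∅
      B∩K≢∅ : Nonempty (B ∩ K)
      B∩K≢∅ = subst Nonempty (∩-comm K B) (p∩[q∪r]≢∅∧p∩q≡∅⇒p∩r≢∅ K∩[A∪B]≢∅ K∩A≡∅)

    conf≡0-shift : ∀ {W} → NonKtSet G t W B → R ⊆ W → KtFree G t (A ∪ B) →
                   ConfIs G t (A ∪ B) R 0 ⇔ ConfIs G t A (R ∪ B) 0
    conf≡0-shift nonKt R⊆W free = mk⇔
      (from conf≡0⇔ ∘ shiftʳ ∘ to conf≡0⇔)
      (from conf≡0⇔ ∘ shiftˡ ∘ to conf≡0⇔)
      where
      R⊆R∪B : R ⊆ R ∪ B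
      R⊆R∪B = p⊆p∪q B
      cliques⊆R : ∀ K → CliqueIn G t (R ∪ B) K → K ⊆ R
      cliques⊆R = cliques-avoid-nonKt nonKt R⊆W

      shiftʳ : MinimumTransversalMeetsPr (A ∪ B) R → MinimumTransversalMeetsPr A (R ∪ B)
      shiftʳ (H , (H⊆R , meetsCliques , meetsPr) , optAtLeast) =
        H , hits-extend R⊆R∪B cliques⊆R (H⊆R , meetsCliques , meetsAll-pr-shiftʳ free meetsPr)
          , to (optAtLeast⇔ R⊆R∪B cliques⊆R) optAtLeast

      shiftˡ : MinimumTransversalMeetsPr A (R ∪ B) → MinimumTransversalMeetsPr (A ∪ B) R
      shiftˡ (H , hits@(_ , meetsCliques , meetsPr) , optAtLeast) =
        H , (H⊆R , (λ K → meetsCliques K ∘ cliqueIn-mono R⊆R∪B)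
                 , meetsAll-pr-shiftˡ nonKt R⊆W H⊆R meetsPr)
          , from (optAtLeast⇔ R⊆R∪B cliques⊆R) optAtLeast
        where
        H⊆R : H ⊆ R
        H⊆R = ∣p∣≤∣p∩q∣⇒p⊆q
          (optAtLeast (H ∩ R) (hits-extend R⊆R∪B cliques⊆R (hits-restrict R⊆R∪B hits)))

lemma44 : ∀ {n} (G : Graph n) (t λ' : ℕ) → 3 ≤ t →
    (X : Subset n) → BedLe G t (∁ X) λ' →
    (N : Subset n) → NonKtSet G t (∁ X) N →
    (X' N' R' : Subset n) → X' ⊆ X → N' ⊆ N → R' ⊆ ∁ X →
    Empty (R' ∩ N') → KtFree G t (X' ∪ N') →
    ConfIs G t (X' ∪ N') R' 0 ⇔ ConfIs G t X' (R' ∪ N') 0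
lemma44 G t _ _ _ _ _ nonKt _ _ _ _ N'⊆N R'⊆∁X _ free =
  conf≡0-shift G t (nonKtSet-anti G t N'⊆N nonKt) R'⊆∁X free
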